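{- Let $(u_n)_{n\ge1}$ be the sequence defined by $u_1=1$, $u_2=2$, $u_3=3$ and, for all $n\ge2$, $u_{2n}=u_{2n-1}+u_{2n-2}$ and $u_{2n+1}=u_{2n}+u_{2n-2}$. Then the set of positive integer solutions $(x,y)$ of $x^2-2y^2=1$ is exactly $\{(u_{4n-1},u_{4n-2}) : n\ge1\}$. -}

module Defs where

open import Data.Nat using (ℕ; zero; suc; _+_; _*_; _∸_)
open import Data.Nat.Base using (_/_; _%_)
open import Data.Product using (_×_; _,_; proj₁; proj₂)

-- pair k = (u_{2k}, u_{2k+1}) for k ≥ 1, following the recurrences
--   u_{2n} = u_{2n-1} + u_{2n-2},  u_{2n+1} = u_{2n} + u_{2n-2}  (n ≥ 2)
-- with u_2 = 2, u_3 = 3.  (pair 0 is an unused dummy value.)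
pair : ℕ → ℕ × ℕ
pair zero = (0 , 1)
pair (suc zero) = (2 , 3)
pair (suc (suc k)) with pair (suc k)
... | (e , o) = (o + e , (o + e) + e)

u : ℕ → ℕ
u zero = 0
u (suc zero) = 1
u (suc (suc m)) with m % 2
... | zero = proj₁ (pair (suc (m / 2)))
... | suc _ = proj₂ (pair (suc (m / 2)))

{-# OPTIONS --safe #-}
module Submission where

-- The map (y , x) ↦ (x + y , x + 2y), i.e. multiplication of x + y√2 by 1 + √2, turns a
-- solution of x² − 2y² = ±1 into one of x² − 2y² = ∓1, and the pairs (u_{2k} , u_{2k+1})
-- are its iterates starting from (1 , 1).  Conversely a solution with y ≥ 2 satisfies
-- y < x < 2y, so it has a preimage with smaller positive y; descending, one reaches (1 , 1).
-- Hence the solutions of x² − 2y² = 1 are exactly the odd iterates (u_{4n−2} , u_{4n−1}).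

open import Defs
open import Data.Nat using (ℕ; zero; suc; _+_; _*_; _∸_; _≥_; _>_; _≤_; _<_; z≤n; s≤s; _/_; _%_)
open import Data.Nat.Properties
open import Data.Nat.DivMod using ([m+kn]%n≡m%n; m*n%n≡0; m*n/n≡m; +-distrib-/)
open import Data.Nat.Induction using (<-wellFounded)
open import Data.Nat.Tactic.RingSolver using (solve-∀)
open import Data.Empty using (⊥-elim)
open import Data.Product using (_×_; _,_; ∃-syntax; proj₁; proj₂)
open import Induction.WellFounded using (Acc; acc)
open import Relation.Binary.PropositionalEquality
open import Function.Bundles using (_⇔_; mk⇔; Equivalence)
open Equivalence using (to; from)

Pell⁺ Pell⁻ : ℕ × ℕ → Set
Pell⁺ (y , x) = x * x ≡ 1 + 2 * (y * y)
Pell⁻ (y , x) = x * x + 1 ≡ 2 * (y * y)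

pellStep : ℕ × ℕ → ℕ × ℕ
pellStep (y , x) = (x + y , x + y + y)

pell : ℕ → ℕ × ℕ
pell zero    = (1 , 1)
pell (suc k) = pellStep (pell k)

pair≡pell : ∀ k → pair (suc k) ≡ pell (suc k)
pair≡pell zero    = refl
pair≡pell (suc k) = trans (pair-suc k) (cong pellStep (pair≡pell k))
  where
  pair-suc : ∀ k → pair (suc (suc k)) ≡ pellStep (pair (suc k))
  pair-suc k with pair (suc k)
  ... | _ = refl

+-transfer-1 : ∀ a b c d → a + b ≡ c + d → (a ≡ 1 + c ⇔ b + 1 ≡ d)
+-transfer-1 a b c d eq = mk⇔ a≡1+c⇒b+1≡d b+1≡d⇒a≡1+c
  where
  open ≡-Reasoning
  c+[b+1]≡1+c+b : c + (b + 1) ≡ 1 + c + b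
  c+[b+1]≡1+c+b = trans (cong (c +_) (+-comm b 1)) (+-suc c b)
  a≡1+c⇒b+1≡d : a ≡ 1 + c → b + 1 ≡ d
  a≡1+c⇒b+1≡d a≡1+c = +-cancelˡ-≡ c _ _ (begin
    c + (b + 1)  ≡⟨ c+[b+1]≡1+c+b ⟩
    1 + c + b    ≡⟨ cong (_+ b) (sym a≡1+c) ⟩
    a + b        ≡⟨ eq ⟩
    c + d        ∎)
  b+1≡d⇒a≡1+c : b + 1 ≡ d → a ≡ 1 + c
  b+1≡d⇒a≡1+c b+1≡d = +-cancelʳ-≡ b _ _ (begin
    a + b        ≡⟨ eq ⟩
    c + d        ≡⟨ cong (c +_) (sym b+1≡d) ⟩
    c + (b + 1)  ≡⟨ c+[b+1]≡1+c+b ⟩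
    1 + c + b    ∎)

pellStep-identity : ∀ y x → (x + y + y) * (x + y + y) + x * x ≡ 2 * ((x + y) * (x + y)) + 2 * (y * y)
pellStep-identity = solve-∀

Pell⁺-pellStep⇔Pell⁻ : ∀ p → Pell⁺ (pellStep p) ⇔ Pell⁻ p
Pell⁺-pellStep⇔Pell⁻ (y , x) = +-transfer-1 _ _ _ _ (pellStep-identity y x)

Pell⁺⇔Pell⁻-pellStep : ∀ p → Pell⁺ p ⇔ Pell⁻ (pellStep p)
Pell⁺⇔Pell⁻-pellStep (y , x) = +-transfer-1 _ _ _ _ (begin
  x * x + (x + y + y) * (x + y + y)          ≡⟨ +-comm (x * x) _ ⟩
  (x + y + y) * (x + y + y) + x * x          ≡⟨ pellStep-identity y x ⟩
  2 * ((x + y) * (x + y)) + 2 * (y * y)      ≡⟨ +-comm _ (2 * (y * y)) ⟩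
  2 * (y * y) + 2 * ((x + y) * (x + y))      ∎)
  where open ≡-Reasoning

pell-even-Pell⁻ : ∀ j → Pell⁻ (pell (j * 2))
pell-even-Pell⁻ zero    = refl
pell-even-Pell⁻ (suc j) =
  to (Pell⁺⇔Pell⁻-pellStep (pell (suc (j * 2))))
     (from (Pell⁺-pellStep⇔Pell⁻ (pell (j * 2))) (pell-even-Pell⁻ j))

pell-odd-Pell⁺ : ∀ j → Pell⁺ (pell (suc (j * 2)))
pell-odd-Pell⁺ j = from (Pell⁺-pellStep⇔Pell⁻ (pell (j * 2))) (pell-even-Pell⁻ j)

m*m<n*n⇒m<n : ∀ {m n} → m * m < n * n → m < n
m*m<n*n⇒m<n m*m<n*n = ≰⇒> λ n≤m → <⇒≱ m*m<n*n (*-mono-≤ n≤m n≤m)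

Pell⁺⇒y<x : ∀ {y x} → Pell⁺ (y , x) → y < x
Pell⁺⇒y<x {y} {x} h = m*m<n*n⇒m<n (begin-strict
  y * y            ≤⟨ m≤m+n (y * y) _ ⟩
  2 * (y * y)      <⟨ n<1+n _ ⟩
  1 + 2 * (y * y)  ≡⟨ sym h ⟩
  x * x            ∎)
  where open ≤-Reasoning

Pell⁻⇒y<x : ∀ {y x} → 1 < y → Pell⁻ (y , x) → y < x
Pell⁻⇒y<x {y} {x} 1<y h = m*m<n*n⇒m<n (+-cancelʳ-< 1 (y * y) (x * x) (begin-strict
  y * y + 1        <⟨ +-monoʳ-< (y * y) (*-mono-≤ 1<y (<⇒≤ 1<y)) ⟩
  y * y + y * y    ≡⟨ cong (y * y +_) (sym (+-identityʳ (y * y))) ⟩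
  2 * (y * y)      ≡⟨ sym h ⟩
  x * x + 1        ∎))
  where open ≤-Reasoning

x*x≤1+2*y*y⇒x<y+y : ∀ {y x} → 0 < y → x * x ≤ 1 + 2 * (y * y) → x < y + y
x*x≤1+2*y*y⇒x<y+y {y} {x} 0<y h = m*m<n*n⇒m<n (begin-strict
  x * x                          ≤⟨ h ⟩
  1 + 2 * (y * y)                <⟨ +-monoˡ-< (2 * (y * y)) (*-monoʳ-≤ 2 (*-mono-≤ 0<y 0<y)) ⟩
  2 * (y * y) + 2 * (y * y)      ≡⟨ double-square y ⟩
  (y + y) * (y + y)              ∎)
  where
  open ≤-Reasoning
  double-square : ∀ y → 2 * (y * y) + 2 * (y * y) ≡ (y + y) * (y + y)
  double-square = solve-∀

Pell⁺⇒x<y+y : ∀ {y x} → 0 < y → Pell⁺ (y , x) → x < y + y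
Pell⁺⇒x<y+y 0<y h = x*x≤1+2*y*y⇒x<y+y 0<y (≤-reflexive h)

Pell⁻⇒x<y+y : ∀ {y x} → 0 < y → Pell⁻ (y , x) → x < y + y
Pell⁻⇒x<y+y {y} {x} 0<y h =
  x*x≤1+2*y*y⇒x<y+y 0<y (≤-trans (m≤m+n (x * x) 1) (≤-trans (≤-reflexive h) (m≤n+m _ 1)))

pellStep-preimage : ∀ {y x} → y < x → x < y + y →
                    ∃[ p ] (0 < proj₁ p × proj₁ p < y × pellStep p ≡ (y , x))
pellStep-preimage {y} {x} y<x x<y+y = (d , y ∸ d) , m<n⇒0<n∸m y<x , d<y , cong₂ _,_ y∸d+d≡y y∸d+d+d≡x
  where
  d = x ∸ y
  y+d≡x : y + d ≡ x
  y+d≡x = m+[n∸m]≡n (<⇒≤ y<x)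
  d<y : d < y
  d<y = +-cancelˡ-< y d y (subst (_< y + y) (sym y+d≡x) x<y+y)
  y∸d+d≡y : y ∸ d + d ≡ y
  y∸d+d≡y = m∸n+n≡m (<⇒≤ d<y)
  y∸d+d+d≡x : y ∸ d + d + d ≡ x
  y∸d+d+d≡x = trans (cong (_+ d) y∸d+d≡y) y+d≡x

mutual
  Pell⁺⇒pell-odd : ∀ {y x} → Acc _<_ y → 0 < y → Pell⁺ (y , x) → ∃[ j ] pell (suc (j * 2)) ≡ (y , x)
  Pell⁺⇒pell-odd {y} {x} (acc rs) 0<y h
    with pellStep-preimage (Pell⁺⇒y<x {y} {x} h) (Pell⁺⇒x<y+y {y} {x} 0<y h)
  ... | p , 0<d , d<y , p↦yx
    with Pell⁻⇒pell-even {proj₁ p} {proj₂ p} (rs d<y) 0<d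
           (to (Pell⁺-pellStep⇔Pell⁻ p) (subst Pell⁺ (sym p↦yx) h))
  ... | j , pell≡p = j , trans (cong pellStep pell≡p) p↦yx

  Pell⁻⇒pell-even : ∀ {y x} → Acc _<_ y → 0 < y → Pell⁻ (y , x) → ∃[ j ] pell (j * 2) ≡ (y , x)
  Pell⁻⇒pell-even {1} {0}           _   _   ()
  Pell⁻⇒pell-even {1} {1}           _   _   _ = 0 , refl
  Pell⁻⇒pell-even {1} {suc (suc _)} _   0<y h = ⊥-elim (<⇒≱ (Pell⁻⇒x<y+y {1} 0<y h) (s≤s (s≤s z≤n)))
  Pell⁻⇒pell-even {suc (suc _)}     rec _   h = Pell⁻⇒pell-even-descend rec (s≤s (s≤s z≤n)) h

  Pell⁻⇒pell-even-descend : ∀ {y x} → Acc _<_ y → 1 < y → Pell⁻ (y , x) → ∃[ j ] pell (j * 2) ≡ (y , x)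
  Pell⁻⇒pell-even-descend {y} {x} (acc rs) 1<y h
    with pellStep-preimage (Pell⁻⇒y<x {y} {x} 1<y h) (Pell⁻⇒x<y+y {y} {x} (<⇒≤ 1<y) h)
  ... | p , 0<d , d<y , p↦yx
    with Pell⁺⇒pell-odd {proj₁ p} {proj₂ p} (rs d<y) 0<d
           (from (Pell⁺⇔Pell⁻-pellStep p) (subst Pell⁻ (sym p↦yx) h))
  ... | j , pell≡p = suc j , trans (cong pellStep pell≡p) p↦yx

[m*2]%2≡0 : ∀ m → (m * 2) % 2 ≡ 0
[m*2]%2≡0 m = m*n%n≡0 m 2

[m*2]/2≡m : ∀ m → (m * 2) / 2 ≡ m
[m*2]/2≡m m = m*n/n≡m m 2

[1+m*2]%2≡1 : ∀ m → (1 + m * 2) % 2 ≡ 1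
[1+m*2]%2≡1 m = [m+kn]%n≡m%n 1 m 2

[1+m*2]/2≡m : ∀ m → (1 + m * 2) / 2 ≡ m
[1+m*2]/2≡m m = trans (+-distrib-/ 1 (m * 2) 1+[m*2]%2<2) ([m*2]/2≡m m)
  where
  1+[m*2]%2<2 : 1 + (m * 2) % 2 < 2
  1+[m*2]%2<2 = subst (λ r → 1 + r < 2) (sym ([m*2]%2≡0 m)) ≤-refl

u-even : ∀ i → u (2 + i * 2) ≡ proj₁ (pair (suc i))
u-even i rewrite [m*2]%2≡0 i | [m*2]/2≡m i = refl

u-odd : ∀ i → u (3 + i * 2) ≡ proj₂ (pair (suc i))
u-odd i rewrite [1+m*2]%2≡1 i | [1+m*2]/2≡m i = refl

u-pell : ∀ j → (u (4 * suc j ∸ 2) , u (4 * suc j ∸ 1)) ≡ pell (suc (j * 2))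
u-pell j = begin
  (u (4 * suc j ∸ 2) , u (4 * suc j ∸ 1))   ≡⟨ cong (λ m → (u (m ∸ 2) , u (m ∸ 1))) (4*[1+n]≡4+n*2*2 j) ⟩
  (u (2 + j * 2 * 2) , u (3 + j * 2 * 2))   ≡⟨ cong₂ _,_ (u-even (j * 2)) (u-odd (j * 2)) ⟩
  pair (suc (j * 2))                        ≡⟨ pair≡pell (j * 2) ⟩
  pell (suc (j * 2))                        ∎
  where
  open ≡-Reasoning
  4*[1+n]≡4+n*2*2 : ∀ n → 4 * suc n ≡ 4 + n * 2 * 2
  4*[1+n]≡4+n*2*2 = solve-∀

lemma10 : ∀ (x y : ℕ) → x > 0 → y > 0 →
          ((x * x ≡ 1 + 2 * (y * y)) ⇔ (∃[ n ] (n ≥ 1 × x ≡ u (4 * n ∸ 1) × y ≡ u (4 * n ∸ 2))))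
lemma10 x y _ 0<y = mk⇔ solution⇒index index⇒solution
  where
  solution⇒index : Pell⁺ (y , x) → ∃[ n ] (n ≥ 1 × x ≡ u (4 * n ∸ 1) × y ≡ u (4 * n ∸ 2))
  solution⇒index h with Pell⁺⇒pell-odd {y} {x} (<-wellFounded y) 0<y h
  ... | j , pell≡yx = suc j , s≤s z≤n , cong proj₂ yx≡u , cong proj₁ yx≡u
    where
    yx≡u : (y , x) ≡ (u (4 * suc j ∸ 2) , u (4 * suc j ∸ 1))
    yx≡u = sym (trans (u-pell j) pell≡yx)

  index⇒solution : ∃[ n ] (n ≥ 1 × x ≡ u (4 * n ∸ 1) × y ≡ u (4 * n ∸ 2)) → Pell⁺ (y , x)
  index⇒solution (suc j , _ , x≡u , y≡u) =
    subst Pell⁺ (trans (sym (u-pell j)) (cong₂ _,_ (sym y≡u) (sym x≡u))) (pell-odd-Pell⁺ j)
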